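{- Let $\overline{m}G$ be a negative mixed star block graph with $k$ blocks $B_1,\dots,B_k$ of orders $n_1,\dots,n_k$, and for each $j$ let $D_{n_j}$ denote the determinant of the adjacency matrix of $\overline{m}K_{n_j}$ with one vertex deleted. Then $$\det(\overline{m}G)=\sum_{i=1}^k\det(\overline{m}K_{n_i})\prod_{j=1,\,j\ne i}^kD_{n_j}.$$
   Context: The negative mixed complete graph $\overline{m}K_n$ ($n>3$) is obtained from the directed cycle $v_1\to v_2\to\dots\to v_n\to v_1$ with all arcs of weight $-1$ by adding, with weight $+1$, both arcs between every pair of vertices non-adjacent in the underlying cycle (by symmetry, deleting any vertex gives the same determinant). A negative mixed star block graph is a strongly connected digraph whose blocks are negative mixed complete graphs $B_i\cong\overline{m}K_{n_i}$ and which has (at most) one cut-vertex, common to all blocks. $\det$ of a weighted digraph is the determinant of its adjacency matrix ($(p,q)$ entry equals the weight of the arc from vertex $p$ to vertex $q$, $0$ if none). -}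

module Defs where

open import Data.Nat using (ℕ; zero; suc; _≡ᵇ_; _<_)
open import Data.Bool using (Bool; true; false; if_then_else_; _∨_; _∧_)
open import Data.Integer using (ℤ; +_; -_; _*_; _+_; 0ℤ; 1ℤ)
open import Data.Fin using (Fin; zero; suc; toℕ; punchIn; _≟_)
open import Data.Product using (Σ; ∃; ∃-syntax; _×_)
open import Relation.Binary.PropositionalEquality using (_≡_; _≢_)
open import Relation.Nullary using (¬_; does)

Matrix : ℕ → Set
Matrix n = Fin n → Fin n → ℤ

sumᶠ : ∀ {n} → (Fin n → ℤ) → ℤ
sumᶠ {zero}  f = 0ℤ
sumᶠ {suc n} f = f zero + sumᶠ (λ i → f (suc i))

prodᶠ : ∀ {n} → (Fin n → ℤ) → ℤ
prodᶠ {zero}  f = 1ℤ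
prodᶠ {suc n} f = f zero * prodᶠ (λ i → f (suc i))

sign : ℕ → ℤ
sign zero = 1ℤ
sign (suc m) = - sign m

det : ∀ {n} → Matrix n → ℤ
det {zero}  A = 1ℤ
det {suc n} A = sumᶠ (λ j → sign (toℕ j) * (A zero j * det (λ r c → A (suc r) (punchIn j c))))

-- Weight of the arc v_{a+1} → v_{b+1} in the negative mixed complete graph on
-- n vertices, vertices numbered 0 .. n-1 (index a stands for v_{a+1}).
-- Cycle arcs a → a+1 (mod n) have weight -1; the reverse direction of a cycle
-- edge has no arc (0); diagonal 0; non-adjacent pairs have weight +1.
succᵇ : ℕ → ℕ → ℕ → Bool
succᵇ n a b = (b ≡ᵇ suc a) ∨ ((suc a ≡ᵇ n) ∧ (b ≡ᵇ 0))

mKw : ℕ → ℕ → ℕ → ℤ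
mKw n a b =
  if succᵇ n a b then - 1ℤ
  else if (a ≡ᵇ b) ∨ succᵇ n b a then 0ℤ
  else 1ℤ

mK : (n : ℕ) → Matrix n
mK n a b = mKw n (toℕ a) (toℕ b)

D : ℕ → ℤ
D zero    = 0ℤ
D (suc m) = det (λ a b → mK (suc m) (suc a) (suc b))

-- A : Matrix N is the adjacency matrix of a negative mixed star block graph
-- with k blocks of orders n i, given by embeddings f i : Fin (n i) → Fin N
-- (f i realises block B_i ≅ m̄K_{n i}) and common cut vertex c.
record IsNegMixedStarBlock (N k : ℕ) (n : Fin k → ℕ) (A : Matrix N) : Set where
  field
    c        : Fin N
    f        : (i : Fin k) → Fin (n i) → Fin N
    f-inj    : ∀ i a b → f i a ≡ f i b → a ≡ b
    f-cut    : ∀ i → ∃[ a ] f i a ≡ c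
    disjoint : ∀ i j a b → i ≢ j → f i a ≡ f j b → f i a ≡ c
    cover    : ∀ v → ∃[ i ] ∃[ a ] f i a ≡ v
    arcs     : ∀ i a b → A (f i a) (f i b) ≡ mK (n i) a b
    no-arc   : ∀ p q → ¬ (∃[ i ] ∃[ a ] ∃[ b ] (f i a ≡ p × f i b ≡ q)) → A p q ≡ 0ℤ

prodExcept : ∀ {k} → (Fin k → ℕ) → Fin k → ℤ
prodExcept n i = prodᶠ (λ j → if does (j ≟ i) then 1ℤ else D (n j))

-- Relabelling the vertices does not change a determinant, and rotating the vertices of
-- m̄K_n (v_a ↦ v_{a+1}) preserves all its arcs.  So we may number the vertices of a star block
-- graph as: the cut vertex first, then the other vertices of each block in turn, with the cut
-- vertex as vertex v_1 of every block.  The matrix is then an iterated gluing of the blocks at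
-- their first vertex.  If Y has a zero diagonal entry at the glued vertex, then
--   det (glue X Y) = det X · det Y⁻ + det X⁻ · det Y,
-- where ⁻ deletes the glued vertex: split the glued vertex's row into its X-part and its
-- Y-part; each summand is then a block-triangular determinant.  Induction on the number of
-- blocks gives the formula.
module Submission where

open import Defs
open import Data.Nat as ℕ using (ℕ; zero; suc; _<_; _≡ᵇ_; s≤s)
import Data.Nat.Properties as ℕP
open import Data.Integer as ℤ using (ℤ; -_; _+_; _*_; 0ℤ; 1ℤ)
import Data.Integer.Properties as ℤP
open import Data.Integer.Tactic.RingSolver using (solve-∀)
open import Data.Fin as Fin using (Fin; zero; suc; toℕ; punchIn; punchOut; _↑ˡ_; _↑ʳ_; splitAt; _≟_)
import Data.Fin.Properties as FinP
open import Data.Bool using (Bool; if_then_else_; _∨_)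
open import Data.Bool.Properties using (∨-identityʳ)
open import Data.Sum as Sum using (_⊎_; inj₁; inj₂; [_,_])
import Data.Sum.Properties as SumP
open import Data.Product using (Σ; ∃-syntax; _,_; proj₁; proj₂)
open import Data.Empty using (⊥-elim)
open import Function using (_∘_)
open import Function.Bundles using (mk⇔)
open import Function.Definitions using (Injective; StrictlySurjective)
open import Relation.Nullary using (does; yes; no)
open import Relation.Nullary.Decidable using (does-⇔; dec-true; dec-false)
open import Relation.Binary.PropositionalEquality
  using (_≡_; _≢_; refl; sym; trans; cong; cong₂; subst; module ≡-Reasoning)

sumᶠ-cong : ∀ {n} {f g : Fin n → ℤ} → (∀ i → f i ≡ g i) → sumᶠ f ≡ sumᶠ g
sumᶠ-cong {zero}  f≗g = refl
sumᶠ-cong {suc n} f≗g = cong₂ _+_ (f≗g zero) (sumᶠ-cong (f≗g ∘ suc))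

prodᶠ-cong : ∀ {n} {f g : Fin n → ℤ} → (∀ i → f i ≡ g i) → prodᶠ f ≡ prodᶠ g
prodᶠ-cong {zero}  f≗g = refl
prodᶠ-cong {suc n} f≗g = cong₂ _*_ (f≗g zero) (prodᶠ-cong (f≗g ∘ suc))

sumᶠ-+ : ∀ {n} (f g : Fin n → ℤ) → sumᶠ (λ i → f i + g i) ≡ sumᶠ f + sumᶠ g
sumᶠ-+ {zero}  f g = refl
sumᶠ-+ {suc n} f g rewrite sumᶠ-+ (f ∘ suc) (g ∘ suc) =
  interchange (f zero) (g zero) (sumᶠ (f ∘ suc)) (sumᶠ (g ∘ suc))
  where interchange : ∀ a b c d → (a + b) + (c + d) ≡ (a + c) + (b + d)
        interchange = solve-∀

sumᶠ-neg : ∀ {n} (f : Fin n → ℤ) → sumᶠ (λ i → - f i) ≡ - sumᶠ f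
sumᶠ-neg {zero}  f = refl
sumᶠ-neg {suc n} f rewrite sumᶠ-neg (f ∘ suc) = sym (ℤP.neg-distrib-+ (f zero) (sumᶠ (f ∘ suc)))

sumᶠ-*ˡ : ∀ {n} (c : ℤ) (f : Fin n → ℤ) → sumᶠ (λ i → c * f i) ≡ c * sumᶠ f
sumᶠ-*ˡ {zero}  c f = sym (ℤP.*-zeroʳ c)
sumᶠ-*ˡ {suc n} c f rewrite sumᶠ-*ˡ c (f ∘ suc) = sym (ℤP.*-distribˡ-+ c (f zero) (sumᶠ (f ∘ suc)))

sumᶠ-*ʳ : ∀ {n} (c : ℤ) (f : Fin n → ℤ) → sumᶠ (λ i → f i * c) ≡ sumᶠ f * c
sumᶠ-*ʳ {zero}  c f = refl
sumᶠ-*ʳ {suc n} c f rewrite sumᶠ-*ʳ c (f ∘ suc) = sym (ℤP.*-distribʳ-+ c (f zero) (sumᶠ (f ∘ suc)))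

sumᶠ-zero : ∀ {n} (f : Fin n → ℤ) → (∀ i → f i ≡ 0ℤ) → sumᶠ f ≡ 0ℤ
sumᶠ-zero {zero}  f f≗0 = refl
sumᶠ-zero {suc n} f f≗0 rewrite f≗0 zero = trans (ℤP.+-identityˡ _) (sumᶠ-zero (f ∘ suc) (f≗0 ∘ suc))

sumᶠ-splitAt : ∀ p {q} (f : Fin (p ℕ.+ q) → ℤ) →
  sumᶠ f ≡ sumᶠ (λ i → f (i ↑ˡ q)) + sumᶠ (λ j → f (p ↑ʳ j))
sumᶠ-splitAt zero    f = sym (ℤP.+-identityˡ _)
sumᶠ-splitAt (suc p) f rewrite sumᶠ-splitAt p (f ∘ suc) = sym (ℤP.+-assoc (f zero) _ _)

minor₀ : ∀ {n} → Matrix (suc n) → Fin (suc n) → Matrix n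
minor₀ A j r c = A (suc r) (punchIn j c)

minor₀₀ : ∀ {n} → Matrix (suc n) → Matrix n
minor₀₀ A r c = A (suc r) (suc c)

cofactorTerm : ∀ {n} → Matrix (suc n) → Fin (suc n) → ℤ
cofactorTerm A j = sign (toℕ j) * (A zero j * det (minor₀ A j))

det-cong : ∀ {n} {A B : Matrix n} → (∀ r c → A r c ≡ B r c) → det A ≡ det B
det-cong {zero}  A≗B = refl
det-cong {suc n} A≗B = sumᶠ-cong λ j →
  cong₂ (λ x y → sign (toℕ j) * (x * y)) (A≗B zero j) (det-cong (λ r c → A≗B (suc r) (punchIn j c)))

swapAdj : ∀ {n} → Fin n → Fin (suc n) → Fin (suc n)
swapAdj zero    zero          = suc zero
swapAdj zero    (suc zero)    = zero
swapAdj zero    (suc (suc x)) = suc (suc x)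
swapAdj (suc i) zero          = zero
swapAdj (suc i) (suc x)       = suc (swapAdj i x)

sumᶠ-swapAdj : ∀ {n} (i : Fin n) (f : Fin (suc n) → ℤ) → sumᶠ (f ∘ swapAdj i) ≡ sumᶠ f
sumᶠ-swapAdj {suc n} zero f = exchange (f (suc zero)) (f zero) (sumᶠ (λ x → f (suc (suc x))))
  where exchange : ∀ a b c → a + (b + c) ≡ b + (a + c)
        exchange = solve-∀
sumᶠ-swapAdj (suc i) f = cong (f zero +_) (sumᶠ-swapAdj i (f ∘ suc))

-- How deleting column j interacts with swapping columns i and suc i: either j is one of the
-- swapped columns, and the two minors coincide up to the position of j, or j is untouched and
-- the swap survives inside the minor.
data SwapAdjView : ∀ {n} → Fin n → Fin (suc n) → Set where
  moved : ∀ {n} {i : Fin n} {j} →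
          (∀ c → swapAdj i (punchIn j c) ≡ punchIn (swapAdj i j) c) →
          sign (toℕ j) ≡ - sign (toℕ (swapAdj i j)) → SwapAdjView i j
  fixed : ∀ {n} {i : Fin (suc n)} {j : Fin (suc (suc n))} (i′ : Fin n) → swapAdj i j ≡ j →
          (∀ c → swapAdj i (punchIn j c) ≡ punchIn j (swapAdj i′ c)) → SwapAdjView i j

swapAdjView : ∀ {n} (i : Fin n) j → SwapAdjView i j
swapAdjView zero zero       = moved (λ { zero → refl ; (suc c) → refl }) refl
swapAdjView zero (suc zero) = moved (λ { zero → refl ; (suc c) → refl }) refl
swapAdjView {suc (suc n)} zero (suc (suc j)) =
  fixed zero refl (λ { zero → refl ; (suc zero) → refl ; (suc (suc c)) → refl })
swapAdjView (suc i) zero = fixed i refl (λ c → refl)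
swapAdjView (suc i) (suc j) with swapAdjView i j
... | moved comm s     = moved (λ { zero → refl ; (suc c) → cong suc (comm c) }) (cong -_ s)
... | fixed i′ j≡ comm = fixed (suc i′) (cong suc j≡) (λ { zero → refl ; (suc c) → cong suc (comm c) })

det-swapAdjColumns : ∀ {n} (i : Fin n) (A : Matrix (suc n)) → det (λ r c → A r (swapAdj i c)) ≡ - det A
det-swapAdjColumns i A = begin
  sumᶠ (cofactorTerm (λ r c → A r (swapAdj i c)))  ≡⟨ sumᶠ-cong (cofactorTerm-swapAdj i A) ⟩
  sumᶠ (λ j → - cofactorTerm A (swapAdj i j))      ≡⟨ sumᶠ-neg (cofactorTerm A ∘ swapAdj i) ⟩
  - sumᶠ (cofactorTerm A ∘ swapAdj i)              ≡⟨ cong -_ (sumᶠ-swapAdj i (cofactorTerm A)) ⟩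
  - det A                                          ∎
  where
  open ≡-Reasoning
  cofactorTerm-swapAdj : ∀ {n} (i : Fin n) (A : Matrix (suc n)) j →
    cofactorTerm (λ r c → A r (swapAdj i c)) j ≡ - cofactorTerm A (swapAdj i j)
  cofactorTerm-swapAdj i A j with swapAdjView i j
  ... | moved comm s = begin
    sign (toℕ j) * (A zero (swapAdj i j) * det (λ r c → A (suc r) (swapAdj i (punchIn j c))))
      ≡⟨ cong₂ (λ x y → x * (A zero (swapAdj i j) * y)) s (det-cong (λ r c → cong (A (suc r)) (comm c))) ⟩
    (- sign (toℕ (swapAdj i j))) * (A zero (swapAdj i j) * det (minor₀ A (swapAdj i j)))
      ≡⟨ sym (ℤP.neg-distribˡ-* (sign (toℕ (swapAdj i j))) _) ⟩
    - cofactorTerm A (swapAdj i j) ∎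
  ... | fixed i′ j≡ comm = begin
    sign (toℕ j) * (A zero (swapAdj i j) * det (λ r c → A (suc r) (swapAdj i (punchIn j c))))
      ≡⟨ cong (λ x → sign (toℕ j) * (A zero (swapAdj i j) * x))
           (trans (det-cong (λ r c → cong (A (suc r)) (comm c))) (det-swapAdjColumns i′ (minor₀ A j))) ⟩
    sign (toℕ j) * (A zero (swapAdj i j) * - det (minor₀ A j))
      ≡⟨ pull-neg (sign (toℕ j)) (A zero (swapAdj i j)) _ ⟩
    - (sign (toℕ j) * (A zero (swapAdj i j) * det (minor₀ A j)))
      ≡⟨ cong (λ y → - (sign (toℕ y) * (A zero (swapAdj i j) * det (minor₀ A y)))) (sym j≡) ⟩
    - cofactorTerm A (swapAdj i j) ∎
    where pull-neg : ∀ a b c → a * (b * - c) ≡ - (a * (b * c))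
          pull-neg = solve-∀

-- The shape of a double Laplace expansion along the first two rows.
doubleSum : ∀ {m} → (Fin (suc m) → Fin (suc m) → ℤ) → ℤ
doubleSum H = sumᶠ (λ j → sumᶠ (λ l → (sign (toℕ j) * sign (toℕ l)) * H j (punchIn j l)))

doubleSum-suc : ∀ {m} (H : Fin (suc (suc m)) → Fin (suc (suc m)) → ℤ) →
  doubleSum H ≡ sumᶠ (λ l → sign (toℕ l) * H zero (suc l))
                + (- sumᶠ (λ j → sign (toℕ j) * H (suc j) zero) + doubleSum (λ x y → H (suc x) (suc y)))
doubleSum-suc H = cong₂ _+_
  (sumᶠ-cong (λ l → one-left (sign (toℕ l)) (H zero (suc l))))
  (begin
    sumᶠ (λ j → (- sign (toℕ j) * 1ℤ) * H (suc j) zero + sumᶠ (inner j))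
      ≡⟨ sumᶠ-cong (λ j → cong (_+ sumᶠ (inner j)) (neg-left (sign (toℕ j)) (H (suc j) zero))) ⟩
    sumᶠ (λ j → - (sign (toℕ j) * H (suc j) zero) + sumᶠ (inner j))
      ≡⟨ sumᶠ-+ (λ j → - (sign (toℕ j) * H (suc j) zero)) (sumᶠ ∘ inner) ⟩
    sumᶠ (λ j → - (sign (toℕ j) * H (suc j) zero)) + sumᶠ (sumᶠ ∘ inner)
      ≡⟨ cong₂ _+_ (sumᶠ-neg (λ j → sign (toℕ j) * H (suc j) zero))
                   (sumᶠ-cong (λ j → sumᶠ-cong (λ l → neg-neg (sign (toℕ j)) (sign (toℕ l)) (H (suc j) (suc (punchIn j l)))))) ⟩
    - sumᶠ (λ j → sign (toℕ j) * H (suc j) zero) + doubleSum (λ x y → H (suc x) (suc y)) ∎)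
  where
  open ≡-Reasoning
  inner : _ → _ → ℤ
  inner j l = (- sign (toℕ j) * - sign (toℕ l)) * H (suc j) (suc (punchIn j l))
  one-left : ∀ a b → (1ℤ * a) * b ≡ a * b
  one-left = solve-∀
  neg-left : ∀ a b → (- a * 1ℤ) * b ≡ - (a * b)
  neg-left = solve-∀
  neg-neg : ∀ a b c → (- a * - b) * c ≡ (a * b) * c
  neg-neg = solve-∀

doubleSum-flip : ∀ {m} (H : Fin (suc m) → Fin (suc m) → ℤ) → doubleSum H ≡ - doubleSum (λ x y → H y x)
doubleSum-flip {zero}  H = refl
doubleSum-flip {suc m} H = begin
  doubleSum H                   ≡⟨ doubleSum-suc H ⟩
  row + (- col + rest)          ≡⟨ cong (λ w → row + (- col + w)) (doubleSum-flip (λ x y → H (suc x) (suc y))) ⟩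
  row + (- col + - restᵀ)       ≡⟨ rearrange row col restᵀ ⟩
  - (col + (- row + restᵀ))     ≡⟨ cong -_ (sym (doubleSum-suc (λ x y → H y x))) ⟩
  - doubleSum (λ x y → H y x)   ∎
  where
  open ≡-Reasoning
  row   = sumᶠ (λ l → sign (toℕ l) * H zero (suc l))
  col   = sumᶠ (λ j → sign (toℕ j) * H (suc j) zero)
  rest  = doubleSum (λ x y → H (suc x) (suc y))
  restᵀ = doubleSum (λ x y → H (suc y) (suc x))
  rearrange : ∀ x y z → x + (- y + - z) ≡ - (y + (- x + z))
  rearrange = solve-∀

-- punchOutTotal x y is the position of y once x is deleted (junk value zero when y ≡ x).
punchOutTotal : ∀ {n} → Fin (suc (suc n)) → Fin (suc (suc n)) → Fin (suc n)
punchOutTotal zero    zero    = zero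
punchOutTotal zero    (suc y) = y
punchOutTotal (suc x) zero    = zero
punchOutTotal {zero}  (suc x) (suc y) = zero
punchOutTotal {suc n} (suc x) (suc y) = suc (punchOutTotal x y)

punchOutTotal-punchIn : ∀ {n} (j : Fin (suc (suc n))) l → punchOutTotal j (punchIn j l) ≡ l
punchOutTotal-punchIn zero    l       = refl
punchOutTotal-punchIn (suc j) zero    = refl
punchOutTotal-punchIn {suc n} (suc j) (suc l) = cong suc (punchOutTotal-punchIn j l)

-- Deleting column j and then column l of the rest is deleting the same two columns in the other order.
punchIn-exchange : ∀ {n} (j : Fin (suc (suc n))) (l : Fin (suc n)) (c : Fin n) →
  punchIn j (punchIn l c) ≡ punchIn (punchIn j l) (punchIn (punchOutTotal (punchIn j l) j) c)
punchIn-exchange zero    l       c       = refl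
punchIn-exchange (suc j) zero    c       = refl
punchIn-exchange {suc n} (suc j) (suc l) zero    = refl
punchIn-exchange {suc n} (suc j) (suc l) (suc c) = cong suc (punchIn-exchange j l c)

minor₀₁ : ∀ {n} → Matrix (suc (suc n)) → Fin (suc (suc n)) → Fin (suc (suc n)) → Matrix n
minor₀₁ A x y r c = A (suc (suc r)) (punchIn x (punchIn (punchOutTotal x y) c))

module _ {n} (A : Matrix (suc (suc n))) where

  det-expand₀₁ : det A ≡ doubleSum (λ x y → (A zero x * A (suc zero) y) * det (minor₀₁ A x y))
  det-expand₀₁ = sumᶠ-cong λ j → sym (begin
    sumᶠ (λ l → (sign (toℕ j) * sign (toℕ l)) * ((A zero j * A (suc zero) (punchIn j l)) * det (minor₀₁ A j (punchIn j l))))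
      ≡⟨ sumᶠ-cong (λ l → trans
           (cong (λ y → (sign (toℕ j) * sign (toℕ l)) * ((A zero j * A (suc zero) (punchIn j l)) * det y))
             (cong (λ z r c → A (suc (suc r)) (punchIn j (punchIn z c))) (punchOutTotal-punchIn j l)))
           (sym (regroup (sign (toℕ j)) (A zero j) (sign (toℕ l)) (A (suc zero) (punchIn j l)) _))) ⟩
    sumᶠ (λ l → sign (toℕ j) * (A zero j * cofactorTerm (minor₀ A j) l))
      ≡⟨ sumᶠ-*ˡ (sign (toℕ j)) (λ l → A zero j * cofactorTerm (minor₀ A j) l) ⟩
    sign (toℕ j) * sumᶠ (λ l → A zero j * cofactorTerm (minor₀ A j) l)
      ≡⟨ cong (sign (toℕ j) *_) (sumᶠ-*ˡ (A zero j) (cofactorTerm (minor₀ A j))) ⟩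
    sign (toℕ j) * (A zero j * det (minor₀ A j)) ∎)
    where
    open ≡-Reasoning
    regroup : ∀ sj a sl b d → sj * (a * (sl * (b * d))) ≡ (sj * sl) * ((a * b) * d)
    regroup = solve-∀

  det-minor₀₁-exchange : ∀ j l → det (minor₀₁ A j (punchIn j l)) ≡ det (minor₀₁ A (punchIn j l) j)
  det-minor₀₁-exchange j l = det-cong λ r c → cong (A (suc (suc r)))
    (trans (cong (λ z → punchIn j (punchIn z c)) (punchOutTotal-punchIn j l)) (punchIn-exchange j l c))

-- Expanded along its first two rows at once, the determinant is a doubleSum; swapping those
-- rows transposes the summand, which negates a doubleSum.
det-swapRows₀₁ : ∀ {n} (A : Matrix (suc (suc n))) → det (λ r c → A (swapAdj zero r) c) ≡ - det A
det-swapRows₀₁ A = begin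
  det A′                                                      ≡⟨ det-expand₀₁ A′ ⟩
  doubleSum (λ x y → (A (suc zero) x * A zero y) * N x y)     ≡⟨ sumᶠ-cong (λ j → sumᶠ-cong (λ l →
                                                                   cong ((sign (toℕ j) * sign (toℕ l)) *_) (swapped j l))) ⟩
  doubleSum (λ x y → (A zero y * A (suc zero) x) * N y x)     ≡⟨ doubleSum-flip (λ x y → (A zero y * A (suc zero) x) * N y x) ⟩
  - doubleSum (λ x y → (A zero x * A (suc zero) y) * N x y)   ≡⟨ cong -_ (sym (det-expand₀₁ A)) ⟩
  - det A                                                     ∎
  where
  open ≡-Reasoning
  A′ = λ r c → A (swapAdj zero r) c
  N = λ x y → det (minor₀₁ A x y)
  swapped : ∀ j l → (A (suc zero) j * A zero (punchIn j l)) * N j (punchIn j l)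
                  ≡ (A zero (punchIn j l) * A (suc zero) j) * N (punchIn j l) j
  swapped j l = cong₂ _*_ (ℤP.*-comm (A (suc zero) j) _) (det-minor₀₁-exchange A j l)

det-swapAdjRows : ∀ {n} (i : Fin n) (A : Matrix (suc n)) → det (λ r c → A (swapAdj i r) c) ≡ - det A
det-swapAdjRows zero    A = det-swapRows₀₁ A
det-swapAdjRows (suc i) A = trans
  (sumᶠ-cong (λ j → trans (cong (λ w → sign (toℕ j) * (A zero j * w)) (det-swapAdjRows i (minor₀ A j)))
                          (pull-neg (sign (toℕ j)) (A zero j) _)))
  (sumᶠ-neg (cofactorTerm A))
  where pull-neg : ∀ a b c → a * (b * - c) ≡ - (a * (b * c))
        pull-neg = solve-∀

det-relabel-swapAdj : ∀ {n} (i : Fin n) (A : Matrix (suc n)) →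
  det (λ r c → A (swapAdj i r) (swapAdj i c)) ≡ det A
det-relabel-swapAdj i A = begin
  det (λ r c → A (swapAdj i r) (swapAdj i c)) ≡⟨ det-swapAdjRows i (λ r c → A r (swapAdj i c)) ⟩
  - det (λ r c → A r (swapAdj i c))           ≡⟨ cong -_ (det-swapAdjColumns i A) ⟩
  - - det A                                   ≡⟨ ℤP.neg-involutive (det A) ⟩
  det A                                       ∎
  where open ≡-Reasoning

relabel : ∀ {m n} → (Fin m → Fin n) → Matrix n → Matrix m
relabel σ A r c = A (σ r) (σ c)

data Swaps : ℕ → Set where
  []  : ∀ {n} → Swaps n
  _∷_ : ∀ {n} → Fin n → Swaps (suc n) → Swaps (suc n)

apply : ∀ {n} → Swaps n → Fin n → Fin n
apply []      x = x
apply (i ∷ w) x = swapAdj i (apply w x)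

_++_ : ∀ {n} → Swaps n → Swaps n → Swaps n
[]      ++ v = v
(i ∷ w) ++ v = i ∷ (w ++ v)

liftSwaps : ∀ {n} → Swaps n → Swaps (suc n)
liftSwaps []      = []
liftSwaps (i ∷ w) = suc i ∷ liftSwaps w

apply-++ : ∀ {n} (u v : Swaps n) x → apply (u ++ v) x ≡ apply u (apply v x)
apply-++ []      v x = refl
apply-++ (i ∷ u) v x = cong (swapAdj i) (apply-++ u v x)

apply-liftSwaps : ∀ {n} (w : Swaps n) x → apply (liftSwaps w) x ≡ Fin.lift 1 (apply w) x
apply-liftSwaps []      zero    = refl
apply-liftSwaps []      (suc x) = refl
apply-liftSwaps (i ∷ w) x rewrite apply-liftSwaps w x with x
... | zero  = refl
... | suc y = refl

cycle : ∀ {n} → Fin (suc n) → Swaps (suc n)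
cycle zero            = []
cycle {suc n} (suc j) = liftSwaps (cycle j) ++ (zero ∷ [])

apply-cycle-zero : ∀ {n} (j : Fin (suc n)) → apply (cycle j) zero ≡ j
apply-cycle-zero zero            = refl
apply-cycle-zero {suc n} (suc j) = begin
  apply (liftSwaps (cycle j) ++ (zero ∷ [])) zero ≡⟨ apply-++ (liftSwaps (cycle j)) (zero ∷ []) zero ⟩
  apply (liftSwaps (cycle j)) (suc zero)          ≡⟨ apply-liftSwaps (cycle j) (suc zero) ⟩
  suc (apply (cycle j) zero)                      ≡⟨ cong suc (apply-cycle-zero j) ⟩
  suc j                                           ∎
  where open ≡-Reasoning

apply-cycle-suc : ∀ {n} (j : Fin (suc n)) x → apply (cycle j) (suc x) ≡ punchIn j x
apply-cycle-suc zero            x       = refl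
apply-cycle-suc {suc n} (suc j) zero    =
  trans (apply-++ (liftSwaps (cycle j)) (zero ∷ []) (suc zero)) (apply-liftSwaps (cycle j) zero)
apply-cycle-suc {suc n} (suc j) (suc x) = begin
  apply (liftSwaps (cycle j) ++ (zero ∷ [])) (suc (suc x)) ≡⟨ apply-++ (liftSwaps (cycle j)) (zero ∷ []) (suc (suc x)) ⟩
  apply (liftSwaps (cycle j)) (suc (suc x))                ≡⟨ apply-liftSwaps (cycle j) (suc (suc x)) ⟩
  suc (apply (cycle j) (suc x))                            ≡⟨ cong suc (apply-cycle-suc j x) ⟩
  suc (punchIn j x)                                        ∎
  where open ≡-Reasoning

-- A bijection σ factors as (cycle (σ 0)) after (lift τ), with τ the bijection induced on the rest.
bijective⇒swaps : ∀ {n} (σ : Fin n → Fin n) → Injective _≡_ _≡_ σ → StrictlySurjective _≡_ σ →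
  Σ (Swaps n) (λ w → ∀ x → apply w x ≡ σ x)
bijective⇒swaps {zero}  σ inj surj = [] , λ ()
bijective⇒swaps {suc n} σ inj surj = cycle j ++ liftSwaps (proj₁ τ-swaps) , apply-w
  where
  j = σ zero
  σ0≢σsuc : ∀ x → σ zero ≢ σ (suc x)
  σ0≢σsuc x eq with inj eq
  ... | ()
  τ : Fin n → Fin n
  τ x = punchOut (σ0≢σsuc x)
  τ-injective : Injective _≡_ _≡_ τ
  τ-injective {x} {y} eq = FinP.suc-injective (inj (FinP.punchOut-injective (σ0≢σsuc x) (σ0≢σsuc y) eq))
  τ-surjective : StrictlySurjective _≡_ τ
  τ-surjective y with surj (punchIn j y)
  ... | zero  , eq = ⊥-elim (FinP.punchInᵢ≢i j y (sym eq))
  ... | suc x , eq = x , trans (FinP.punchOut-cong j eq) (FinP.punchOut-punchIn j)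
  τ-swaps = bijective⇒swaps τ τ-injective τ-surjective
  apply-w : ∀ x → apply (cycle j ++ liftSwaps (proj₁ τ-swaps)) x ≡ σ x
  apply-w x = trans (apply-++ (cycle j) _ x) (trans (cong (apply (cycle j)) (apply-liftSwaps (proj₁ τ-swaps) x)) (on-lift x))
    where
    on-lift : ∀ x → apply (cycle j) (Fin.lift 1 (apply (proj₁ τ-swaps)) x) ≡ σ x
    on-lift zero    = apply-cycle-zero j
    on-lift (suc x) = trans (apply-cycle-suc j _)
      (trans (cong (punchIn j) (proj₂ τ-swaps x)) (FinP.punchIn-punchOut (σ0≢σsuc x)))

det-relabel-swaps : ∀ {n} (w : Swaps n) (A : Matrix n) → det (relabel (apply w) A) ≡ det A
det-relabel-swaps []      A = refl
det-relabel-swaps (i ∷ w) A = trans (det-relabel-swaps w (relabel (swapAdj i) A)) (det-relabel-swapAdj i A)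

section-injective : ∀ {m n} (σ : Fin m → Fin n) (surj : StrictlySurjective _≡_ σ) →
  Injective _≡_ _≡_ (proj₁ ∘ surj)
section-injective σ surj {x} {y} eq = trans (sym (proj₂ (surj x))) (trans (cong σ eq) (proj₂ (surj y)))

det-relabel : ∀ {m n} (σ : Fin m → Fin n) → Injective _≡_ _≡_ σ → StrictlySurjective _≡_ σ →
  (A : Matrix n) → det (relabel σ A) ≡ det A
det-relabel {m} {n} σ inj surj A with ℕP.≤-antisym (FinP.injective⇒≤ inj) (FinP.injective⇒≤ (section-injective σ surj))
... | refl with bijective⇒swaps σ inj surj
...   | w , w≗σ = trans (det-cong (λ r c → cong₂ A (sym (w≗σ r)) (sym (w≗σ c)))) (det-relabel-swaps w A)

punchIn-↑ˡ : ∀ {p} (j : Fin (suc p)) (c : Fin p) q → punchIn (j ↑ˡ q) (c ↑ˡ q) ≡ punchIn j c ↑ˡ q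
punchIn-↑ˡ zero    c       q = refl
punchIn-↑ˡ (suc j) zero    q = refl
punchIn-↑ˡ (suc j) (suc c) q = cong suc (punchIn-↑ˡ j c q)

punchIn-↑ʳ : ∀ {p} (j : Fin (suc p)) q (v : Fin q) → punchIn (j ↑ˡ q) (p ↑ʳ v) ≡ suc p ↑ʳ v
punchIn-↑ʳ zero          q v = refl
punchIn-↑ʳ {suc p} (suc j) q v = cong suc (punchIn-↑ʳ j q v)

det-blockLowerTriangular : ∀ p q (M : Matrix (p ℕ.+ q)) → (∀ i j → M (i ↑ˡ q) (p ↑ʳ j) ≡ 0ℤ) →
  det M ≡ det (λ r c → M (r ↑ˡ q) (c ↑ˡ q)) * det (λ r c → M (p ↑ʳ r) (p ↑ʳ c))
det-blockLowerTriangular zero    q M zero-block = sym (ℤP.*-identityˡ _)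
det-blockLowerTriangular (suc p) q M zero-block = begin
  det M                                                           ≡⟨ sumᶠ-splitAt (suc p) (cofactorTerm M) ⟩
  sumᶠ (λ j → cofactorTerm M (j ↑ˡ q)) + sumᶠ (λ u → cofactorTerm M (suc p ↑ʳ u))
    ≡⟨ cong₂ _+_ (sumᶠ-cong left-term) (sumᶠ-zero _ right-term) ⟩
  sumᶠ (λ j → cofactorTerm UL j * det LR) + 0ℤ                    ≡⟨ ℤP.+-identityʳ _ ⟩
  sumᶠ (λ j → cofactorTerm UL j * det LR)                         ≡⟨ sumᶠ-*ʳ (det LR) (cofactorTerm UL) ⟩
  det UL * det LR                                                 ∎
  where
  open ≡-Reasoning
  UL = λ r c → M (r ↑ˡ q) (c ↑ˡ q)
  LR = λ r c → M (suc p ↑ʳ r) (suc p ↑ʳ c)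
  right-term : ∀ u → cofactorTerm M (suc p ↑ʳ u) ≡ 0ℤ
  right-term u rewrite zero-block zero u = ℤP.*-zeroʳ (sign (toℕ (suc p ↑ʳ u)))
  left-term : ∀ j → cofactorTerm M (j ↑ˡ q) ≡ cofactorTerm UL j * det LR
  left-term j = trans
    (cong₂ (λ s d → sign s * (M zero (j ↑ˡ q) * d)) (FinP.toℕ-↑ˡ j q)
      (trans (det-blockLowerTriangular p q (minor₀ M (j ↑ˡ q))
                (λ i v → trans (cong (M (suc (i ↑ˡ q))) (punchIn-↑ʳ j q v)) (zero-block (suc i) v)))
             (cong₂ _*_ (det-cong (λ r c → cong (M (suc (r ↑ˡ q))) (punchIn-↑ˡ j c q)))
                        (det-cong (λ r c → cong (M (suc (p ↑ʳ r))) (punchIn-↑ʳ j q c))))))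
    (regroup (sign (toℕ j)) (M zero (j ↑ˡ q)) _ _)
    where regroup : ∀ s m d₁ d₂ → s * (m * (d₁ * d₂)) ≡ (s * (m * d₁)) * d₂
          regroup = solve-∀

withRow₀ : ∀ {n} → Matrix (suc n) → (Fin (suc n) → ℤ) → Matrix (suc n)
withRow₀ A u zero    c = u c
withRow₀ A u (suc r) c = A (suc r) c

det-row₀-additive : ∀ {n} (A : Matrix (suc n)) u v → (∀ j → A zero j ≡ u j + v j) →
  det A ≡ det (withRow₀ A u) + det (withRow₀ A v)
det-row₀-additive A u v A₀≡u+v = trans
  (sumᶠ-cong (λ j → trans (cong (λ w → sign (toℕ j) * (w * det (minor₀ A j))) (A₀≡u+v j))
                          (distrib (sign (toℕ j)) (u j) (v j) (det (minor₀ A j)))))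
  (sumᶠ-+ (λ j → sign (toℕ j) * (u j * det (minor₀ A j))) (λ j → sign (toℕ j) * (v j * det (minor₀ A j))))
  where distrib : ∀ s a b d → s * ((a + b) * d) ≡ s * (a * d) + s * (b * d)
        distrib = solve-∀

blockDiag : ∀ {p q} → Matrix p → Matrix q → Fin p ⊎ Fin q → Fin p ⊎ Fin q → ℤ
blockDiag X Y (inj₁ s) (inj₁ s′) = X s s′
blockDiag X Y (inj₁ s) (inj₂ u′) = 0ℤ
blockDiag X Y (inj₂ u) (inj₁ s′) = 0ℤ
blockDiag X Y (inj₂ u) (inj₂ u′) = Y u u′

-- The vertices 0 of X and Y are identified; the diagonal entry there is taken from X.
glue : ∀ {p q} → Matrix (suc p) → Matrix (suc q) → Matrix (suc (p ℕ.+ q))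
glue     X Y zero    zero    = X zero zero
glue {p} X Y zero    (suc c) = [ X zero ∘ suc , Y zero ∘ suc ] (splitAt p c)
glue {p} X Y (suc r) zero    = [ (λ s → X (suc s) zero) , (λ u → Y (suc u) zero) ] (splitAt p r)
glue {p} X Y (suc r) (suc c) = blockDiag (minor₀₀ X) (minor₀₀ Y) (splitAt p r) (splitAt p c)

glueʳ : ∀ p {q} → Fin (suc q) → Fin (suc (p ℕ.+ q))
glueʳ p zero    = zero
glueʳ p (suc u) = suc (p ↑ʳ u)

module _ {p q : ℕ} (X : Matrix (suc p)) (Y : Matrix (suc q)) where

  glue-↑ˡ : ∀ x y → glue X Y (x ↑ˡ q) (y ↑ˡ q) ≡ X x y
  glue-↑ˡ zero    zero    = refl
  glue-↑ˡ zero    (suc s) rewrite FinP.splitAt-↑ˡ p s q = refl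
  glue-↑ˡ (suc r) zero    rewrite FinP.splitAt-↑ˡ p r q = refl
  glue-↑ˡ (suc r) (suc s) rewrite FinP.splitAt-↑ˡ p r q | FinP.splitAt-↑ˡ p s q = refl

  glue-glueʳ : Y zero zero ≡ X zero zero → ∀ x y → glue X Y (glueʳ p x) (glueʳ p y) ≡ Y x y
  glue-glueʳ Y₀₀≡X₀₀ zero    zero    = sym Y₀₀≡X₀₀
  glue-glueʳ Y₀₀≡X₀₀ zero    (suc s) rewrite FinP.splitAt-↑ʳ p q s = refl
  glue-glueʳ Y₀₀≡X₀₀ (suc r) zero    rewrite FinP.splitAt-↑ʳ p q r = refl
  glue-glueʳ Y₀₀≡X₀₀ (suc r) (suc s) rewrite FinP.splitAt-↑ʳ p q r | FinP.splitAt-↑ʳ p q s = refl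

  glue-↑ˡ-glueʳ : ∀ s u → glue X Y (suc s ↑ˡ q) (glueʳ p (suc u)) ≡ 0ℤ
  glue-↑ˡ-glueʳ s u rewrite FinP.splitAt-↑ˡ p s q | FinP.splitAt-↑ʳ p q u = refl

  glue-glueʳ-↑ˡ : ∀ s u → glue X Y (glueʳ p (suc u)) (suc s ↑ˡ q) ≡ 0ℤ
  glue-glueʳ-↑ˡ s u rewrite FinP.splitAt-↑ˡ p s q | FinP.splitAt-↑ʳ p q u = refl

  glue-glueʳ-suc : ∀ r c → glue X Y (glueʳ p (suc r)) (glueʳ p (suc c)) ≡ Y (suc r) (suc c)
  glue-glueʳ-suc r c rewrite FinP.splitAt-↑ʳ p q r | FinP.splitAt-↑ʳ p q c = refl

  det-minor₀₀-glue : det (minor₀₀ (glue X Y)) ≡ det (minor₀₀ X) * det (minor₀₀ Y)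
  det-minor₀₀-glue = trans (det-blockLowerTriangular p q (minor₀₀ (glue X Y)) glue-↑ˡ-glueʳ)
    (cong₂ _*_ (det-cong (λ r c → glue-↑ˡ (suc r) (suc c))) (det-cong glue-glueʳ-suc))

zeroRow₀ : ∀ {n} → Matrix (suc n) → Matrix (suc n)
zeroRow₀ A = withRow₀ A (λ _ → 0ℤ)

det-glue-zeroRow₀ʳ : ∀ {p q} (X : Matrix (suc p)) (Y : Matrix (suc q)) →
  det (glue X (zeroRow₀ Y)) ≡ det X * det (minor₀₀ Y)
det-glue-zeroRow₀ʳ {p} {q} X Y = trans (det-blockLowerTriangular (suc p) q M zero-block)
  (cong₂ _*_ (det-cong (glue-↑ˡ X (zeroRow₀ Y))) (det-cong (glue-glueʳ-suc X (zeroRow₀ Y))))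
  where
  M = glue X (zeroRow₀ Y)
  zero-block : ∀ i j → M (i ↑ˡ q) (suc p ↑ʳ j) ≡ 0ℤ
  zero-block zero    j rewrite FinP.splitAt-↑ʳ p q j = refl
  zero-block (suc s) j = glue-↑ˡ-glueʳ X (zeroRow₀ Y) s j

swapBlocks : ∀ p q → Fin (q ℕ.+ p) → Fin (p ℕ.+ q)
swapBlocks p q = Fin.join p q ∘ Sum.swap ∘ splitAt q

swapBlocks-involutive : ∀ p q z → swapBlocks p q (swapBlocks q p z) ≡ z
swapBlocks-involutive p q z rewrite FinP.splitAt-join q p (Sum.swap (splitAt p z))
  | SumP.swap-involutive (splitAt p z) = FinP.join-splitAt p q z

swapBlocks-injective : ∀ p q → Injective _≡_ _≡_ (swapBlocks p q)
swapBlocks-injective p q {x} {y} eq =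
  trans (sym (swapBlocks-involutive q p x)) (trans (cong (swapBlocks q p) eq) (swapBlocks-involutive q p y))

lift₁-surjective : ∀ {m n} (f : Fin m → Fin n) → StrictlySurjective _≡_ f → StrictlySurjective _≡_ (Fin.lift 1 f)
lift₁-surjective f surj zero    = zero , refl
lift₁-surjective f surj (suc y) = suc (proj₁ (surj y)) , cong suc (proj₂ (surj y))

det-glue-zeroRow₀ˡ : ∀ {p q} (X : Matrix (suc p)) (Y : Matrix (suc q)) → Y zero zero ≡ 0ℤ →
  det (glue (zeroRow₀ X) Y) ≡ det Y * det (minor₀₀ X)
det-glue-zeroRow₀ˡ {p} {q} X Y Y₀₀≡0 = begin
  det M
    ≡⟨ sym (det-relabel σ σ-injective σ-surjective M) ⟩
  det (relabel σ M)
    ≡⟨ det-blockLowerTriangular (suc q) p (relabel σ M) zero-block ⟩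
  det (λ r c → relabel σ M (r ↑ˡ p) (c ↑ˡ p)) * det (λ r c → relabel σ M (suc q ↑ʳ r) (suc q ↑ʳ c))
    ≡⟨ cong₂ _*_ (det-cong upper) (det-cong lower) ⟩
  det Y * det (minor₀₀ X) ∎
  where
  open ≡-Reasoning
  M = glue (zeroRow₀ X) Y
  σ : Fin (suc (q ℕ.+ p)) → Fin (suc (p ℕ.+ q))
  σ = Fin.lift 1 (swapBlocks p q)
  σ-injective : Injective _≡_ _≡_ σ
  σ-injective = FinP.lift-injective (swapBlocks p q) (swapBlocks-injective p q) 1
  σ-surjective : StrictlySurjective _≡_ σ
  σ-surjective = lift₁-surjective (swapBlocks p q) (λ z → swapBlocks q p z , swapBlocks-involutive p q z)
  swap-↑ˡ : ∀ u → swapBlocks p q (u ↑ˡ p) ≡ p ↑ʳ u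
  swap-↑ˡ u rewrite FinP.splitAt-↑ˡ q u p = refl
  swap-↑ʳ : ∀ s → swapBlocks p q (q ↑ʳ s) ≡ s ↑ˡ q
  swap-↑ʳ s rewrite FinP.splitAt-↑ʳ q p s = refl
  zero-block : ∀ i j → relabel σ M (i ↑ˡ p) (suc q ↑ʳ j) ≡ 0ℤ
  zero-block zero    j rewrite swap-↑ʳ j | FinP.splitAt-↑ˡ p j q = refl
  zero-block (suc u) j rewrite swap-↑ʳ j | swap-↑ˡ u = glue-glueʳ-↑ˡ (zeroRow₀ X) Y j u
  upper : ∀ r c → relabel σ M (r ↑ˡ p) (c ↑ˡ p) ≡ Y r c
  upper zero    zero    = sym Y₀₀≡0
  upper zero    (suc c) rewrite swap-↑ˡ c | FinP.splitAt-↑ʳ p q c = refl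
  upper (suc r) zero    rewrite swap-↑ˡ r | FinP.splitAt-↑ʳ p q r = refl
  upper (suc r) (suc c) rewrite swap-↑ˡ r | swap-↑ˡ c | FinP.splitAt-↑ʳ p q r | FinP.splitAt-↑ʳ p q c = refl
  lower : ∀ r c → relabel σ M (suc q ↑ʳ r) (suc q ↑ʳ c) ≡ X (suc r) (suc c)
  lower r c rewrite swap-↑ʳ r | swap-↑ʳ c | FinP.splitAt-↑ˡ p r q | FinP.splitAt-↑ˡ p c q = refl

det-glue : ∀ {p q} (X : Matrix (suc p)) (Y : Matrix (suc q)) → Y zero zero ≡ 0ℤ →
  det (glue X Y) ≡ det X * det (minor₀₀ Y) + det (minor₀₀ X) * det Y
det-glue {p} {q} X Y Y₀₀≡0 = begin
  det (glue X Y)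
    ≡⟨ det-row₀-additive (glue X Y) (glue X (zeroRow₀ Y) zero) (glue (zeroRow₀ X) Y zero) split-row₀ ⟩
  det (withRow₀ (glue X Y) (glue X (zeroRow₀ Y) zero)) + det (withRow₀ (glue X Y) (glue (zeroRow₀ X) Y zero))
    ≡⟨ cong₂ _+_ (det-cong rows-X) (det-cong rows-Y) ⟩
  det (glue X (zeroRow₀ Y)) + det (glue (zeroRow₀ X) Y)
    ≡⟨ cong₂ _+_ (det-glue-zeroRow₀ʳ X Y) (trans (det-glue-zeroRow₀ˡ X Y Y₀₀≡0) (ℤP.*-comm (det Y) _)) ⟩
  det X * det (minor₀₀ Y) + det (minor₀₀ X) * det Y ∎
  where
  open ≡-Reasoning
  split-row₀ : ∀ c → glue X Y zero c ≡ glue X (zeroRow₀ Y) zero c + glue (zeroRow₀ X) Y zero c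
  split-row₀ zero = sym (ℤP.+-identityʳ (X zero zero))
  split-row₀ (suc c) with splitAt p c
  ... | inj₁ s = sym (ℤP.+-identityʳ _)
  ... | inj₂ u = sym (ℤP.+-identityˡ _)
  rows-X : ∀ r c → withRow₀ (glue X Y) (glue X (zeroRow₀ Y) zero) r c ≡ glue X (zeroRow₀ Y) r c
  rows-X zero    c       = refl
  rows-X (suc r) zero    = refl
  rows-X (suc r) (suc c) = refl
  rows-Y : ∀ r c → withRow₀ (glue X Y) (glue (zeroRow₀ X) Y zero) r c ≡ glue (zeroRow₀ X) Y r c
  rows-Y zero    c       = refl
  rows-Y (suc r) zero    = refl
  rows-Y (suc r) (suc c) = refl

∑ℕ : ∀ {k} → (Fin k → ℕ) → ℕ
∑ℕ {zero}  t = 0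
∑ℕ {suc k} t = t zero ℕ.+ ∑ℕ (t ∘ suc)

star : ∀ {k} {t : Fin k → ℕ} → ((i : Fin k) → Matrix (suc (t i))) → Matrix (suc (∑ℕ t))
star {zero}  B = λ _ _ → 0ℤ
star {suc k} B = glue (B zero) (star (λ i → B (suc i)))

prodExceptᶠ : ∀ {k} → (Fin k → ℤ) → Fin k → ℤ
prodExceptᶠ d i = prodᶠ (λ j → if does (j ≟ i) then 1ℤ else d j)

Loopless : ∀ {k} {t : Fin k → ℕ} → ((i : Fin k) → Matrix (suc (t i))) → Set
Loopless B = ∀ i → B i zero zero ≡ 0ℤ

star-loopless : ∀ {k} {t : Fin k → ℕ} (B : (i : Fin k) → Matrix (suc (t i))) →
  Loopless B → star B zero zero ≡ 0ℤ
star-loopless {zero}  B loopless = refl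
star-loopless {suc k} B loopless = loopless zero

det-minor₀₀-star : ∀ {k} {t : Fin k → ℕ} (B : (i : Fin k) → Matrix (suc (t i))) →
  det (minor₀₀ (star B)) ≡ prodᶠ (λ i → det (minor₀₀ (B i)))
det-minor₀₀-star {zero}  B = refl
det-minor₀₀-star {suc k} B = trans (det-minor₀₀-glue (B zero) (star (λ i → B (suc i))))
  (cong (det (minor₀₀ (B zero)) *_) (det-minor₀₀-star (λ i → B (suc i))))

det-star : ∀ {k} {t : Fin k → ℕ} (B : (i : Fin k) → Matrix (suc (t i))) → Loopless B →
  det (star B) ≡ sumᶠ (λ i → det (B i) * prodExceptᶠ (λ j → det (minor₀₀ (B j))) i)
det-star {zero}  B loopless = refl
det-star {suc k} B loopless = begin
  det (glue (B zero) S)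
    ≡⟨ det-glue (B zero) S (star-loopless B′ (loopless ∘ suc)) ⟩
  det (B zero) * det (minor₀₀ S) + d zero * det S
    ≡⟨ cong₂ (λ x y → det (B zero) * x + d zero * y) (det-minor₀₀-star B′) (det-star B′ (loopless ∘ suc)) ⟩
  det (B zero) * prodᶠ (d ∘ suc) + d zero * sumᶠ (λ i → det (B′ i) * prodExceptᶠ (d ∘ suc) i)
    ≡⟨ cong₂ _+_ (cong (det (B zero) *_) (sym (ℤP.*-identityˡ _)))
                 (sym (trans (sumᶠ-cong (λ i → commute (d zero) (det (B′ i)) (prodExceptᶠ (d ∘ suc) i)))
                             (sumᶠ-*ˡ (d zero) (λ i → det (B′ i) * prodExceptᶠ (d ∘ suc) i)))) ⟩
  sumᶠ (λ i → det (B i) * prodExceptᶠ d i) ∎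
  where
  open ≡-Reasoning
  B′ = λ i → B (suc i)
  S = star B′
  d = λ j → det (minor₀₀ (B j))
  commute : ∀ a b c → b * (a * c) ≡ a * (b * c)
  commute = solve-∀

starEmbed : ∀ {k} (t : Fin k → ℕ) (i : Fin k) → Fin (suc (t i)) → Fin (suc (∑ℕ t))
starEmbed {suc k} t zero    x = x ↑ˡ ∑ℕ (t ∘ suc)
starEmbed {suc k} t (suc i) x = glueʳ (t zero) (starEmbed (t ∘ suc) i x)

starEmbed-zero : ∀ {k} (t : Fin k → ℕ) i → starEmbed t i zero ≡ zero
starEmbed-zero {suc k} t zero    = refl
starEmbed-zero {suc k} t (suc i) rewrite starEmbed-zero (t ∘ suc) i = refl

starEmbed-suc : ∀ {k} (t : Fin k → ℕ) i s → ∃[ u ] starEmbed t i (suc s) ≡ suc u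
starEmbed-suc {suc k} t zero    s = _ , refl
starEmbed-suc {suc k} t (suc i) s with starEmbed-suc (t ∘ suc) i s
... | u , eq rewrite eq = _ , refl

starEmbed-cover : ∀ {k} (t : Fin k → ℕ) (r : Fin (suc (∑ℕ t))) →
  r ≡ zero ⊎ ∃[ i ] ∃[ s ] starEmbed t i (suc s) ≡ r
starEmbed-cover {zero}  t zero    = inj₁ refl
starEmbed-cover {suc k} t zero    = inj₁ refl
starEmbed-cover {suc k} t (suc z) with splitAt (t zero) z in eq
... | inj₁ s = inj₂ (zero , s , cong suc (FinP.splitAt⁻¹-↑ˡ eq))
... | inj₂ u with starEmbed-cover (t ∘ suc) (suc u)
...   | inj₂ (i , s , eq′) = inj₂ (suc i , s , trans (cong (glueʳ (t zero)) eq′) (cong suc (FinP.splitAt⁻¹-↑ʳ eq)))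

star-starEmbed : ∀ {k} {t : Fin k → ℕ} (B : (i : Fin k) → Matrix (suc (t i))) → Loopless B →
  ∀ i x y → star B (starEmbed t i x) (starEmbed t i y) ≡ B i x y
star-starEmbed {suc k} B loopless zero    x y = glue-↑ˡ (B zero) (star (λ i → B (suc i))) x y
star-starEmbed {suc k} B loopless (suc i) x y = trans
  (glue-glueʳ (B zero) (star B′) (trans (star-loopless B′ (loopless ∘ suc)) (sym (loopless zero))) _ _)
  (star-starEmbed B′ (loopless ∘ suc) i x y)
  where B′ = λ i → B (suc i)

star-offBlock : ∀ {k} {t : Fin k → ℕ} (B : (i : Fin k) → Matrix (suc (t i))) →
  ∀ i j s s′ → i ≢ j → star B (starEmbed t i (suc s)) (starEmbed t j (suc s′)) ≡ 0ℤ
star-offBlock {suc k} B zero    zero    s s′ i≢j = ⊥-elim (i≢j refl)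
star-offBlock {suc k} {t} B zero    (suc j) s s′ i≢j with starEmbed-suc (t ∘ suc) j s′
... | u , eq rewrite eq = glue-↑ˡ-glueʳ (B zero) (star (λ i → B (suc i))) s u
star-offBlock {suc k} {t} B (suc i) zero    s s′ i≢j with starEmbed-suc (t ∘ suc) i s
... | u , eq rewrite eq = glue-glueʳ-↑ˡ (B zero) (star (λ i → B (suc i))) s′ u
star-offBlock {suc k} {t} B (suc i) (suc j) s s′ i≢j
  with starEmbed-suc (t ∘ suc) i s | starEmbed-suc (t ∘ suc) j s′
     | star-offBlock (λ i → B (suc i)) i j s s′ (i≢j ∘ cong suc)
... | u , eq | u′ , eq′ | off rewrite eq | eq′ = trans (glue-glueʳ-suc (B zero) (star (λ i → B (suc i))) u u′) off

-- The vertex map from the star to a matrix in which block i is placed by h i and c is the cut vertex.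
fromStar : ∀ {k N} (t : Fin k → ℕ) → ((i : Fin k) → Fin (suc (t i)) → Fin N) → Fin N →
  Fin (suc (∑ℕ t)) → Fin N
fromStar {zero}  t h c _       = c
fromStar {suc k} t h c zero    = c
fromStar {suc k} t h c (suc z) = [ h zero ∘ suc , fromStar (t ∘ suc) (λ i → h (suc i)) c ∘ suc ] (splitAt (t zero) z)

fromStar-zero : ∀ {k N} (t : Fin k → ℕ) h (c : Fin N) → fromStar t h c zero ≡ c
fromStar-zero {zero}  t h c = refl
fromStar-zero {suc k} t h c = refl

fromStar-starEmbed : ∀ {k N} (t : Fin k → ℕ) h (c : Fin N) → (∀ i → h i zero ≡ c) →
  ∀ i x → fromStar t h c (starEmbed t i x) ≡ h i x
fromStar-starEmbed {suc k} t h c h≡c zero zero = sym (h≡c zero)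
fromStar-starEmbed {suc k} t h c h≡c zero (suc s) rewrite FinP.splitAt-↑ˡ (t zero) s (∑ℕ (t ∘ suc)) = refl
fromStar-starEmbed {suc k} t h c h≡c (suc i) x =
  trans (from-glueʳ (starEmbed (t ∘ suc) i x)) (fromStar-starEmbed (t ∘ suc) h′ c (h≡c ∘ suc) i x)
  where
  h′ = λ i → h (suc i)
  from-glueʳ : ∀ w → fromStar t h c (glueʳ (t zero) w) ≡ fromStar (t ∘ suc) h′ c w
  from-glueʳ zero    = sym (fromStar-zero (t ∘ suc) h′ c)
  from-glueʳ (suc u) rewrite FinP.splitAt-↑ʳ (t zero) (∑ℕ (t ∘ suc)) u = refl

record IsStarGluing {N k} {t : Fin k → ℕ} (B : (i : Fin k) → Matrix (suc (t i))) (A : Matrix N) : Set where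
  field
    cut             : Fin N
    block           : (i : Fin k) → Fin (suc (t i)) → Fin N
    block-zero      : ∀ i → block i zero ≡ cut
    block-injective : ∀ i → Injective _≡_ _≡_ (block i)
    meet-at-cut     : ∀ i j x y → i ≢ j → block i x ≡ block j y → x ≡ zero
    cover           : ∀ v → ∃[ i ] ∃[ x ] block i x ≡ v
    arcs            : ∀ i x y → A (block i x) (block i y) ≡ B i x y
    no-arc          : ∀ i j s s′ → i ≢ j → A (block i (suc s)) (block j (suc s′)) ≡ 0ℤ

module _ {N k} {t : Fin k → ℕ} {B : (i : Fin k) → Matrix (suc (t i))} {A : Matrix N}
         (G : IsStarGluing B A) (loopless : Loopless B) where
  open IsStarGluing G

  private
    σ : Fin (suc (∑ℕ t)) → Fin N
    σ = fromStar t block cut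

    σ-starEmbed : ∀ i x → σ (starEmbed t i x) ≡ block i x
    σ-starEmbed = fromStar-starEmbed t block cut block-zero

    decompose : ∀ r → ∃[ i ] ∃[ x ] starEmbed t i x ≡ r
    decompose r with starEmbed-cover t r
    ... | inj₁ refl            = proj₁ (cover cut) , zero , starEmbed-zero t _
    ... | inj₂ (i , s , eq)    = i , suc s , eq

    starEmbed-cut : ∀ i j → starEmbed t i zero ≡ starEmbed t j zero
    starEmbed-cut i j = trans (starEmbed-zero t i) (sym (starEmbed-zero t j))

    σ-injective : Injective _≡_ _≡_ σ
    σ-injective {r} {r′} eq with decompose r | decompose r′
    ... | i , x , refl | j , y , refl with i ≟ j
    ...   | yes refl = cong (starEmbed t i) (block-injective i (trans (sym (σ-starEmbed i x)) (trans eq (σ-starEmbed i y))))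
    ...   | no i≢j   = trans (cong (starEmbed t i) x≡0) (trans (starEmbed-cut i j) (cong (starEmbed t j) (sym y≡0)))
      where
      same = trans (sym (σ-starEmbed i x)) (trans eq (σ-starEmbed j y))
      x≡0 = meet-at-cut i j x y i≢j same
      y≡0 = meet-at-cut j i y x (i≢j ∘ sym) (sym same)

    σ-surjective : StrictlySurjective _≡_ σ
    σ-surjective v with cover v
    ... | i , x , eq = starEmbed t i x , trans (σ-starEmbed i x) eq

    entry-within : ∀ i x y → A (block i x) (block i y) ≡ star B (starEmbed t i x) (starEmbed t i y)
    entry-within i x y = trans (arcs i x y) (sym (star-starEmbed B loopless i x y))

    entry : ∀ i j x y → A (block i x) (block j y) ≡ star B (starEmbed t i x) (starEmbed t j y)
    entry i j x y with i ≟ j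
    entry i j x       y       | yes refl = entry-within i x y
    entry i j zero    y       | no i≢j   = begin
      A (block i zero) (block j y)                    ≡⟨ cong (λ v → A v (block j y)) (trans (block-zero i) (sym (block-zero j))) ⟩
      A (block j zero) (block j y)                    ≡⟨ entry-within j zero y ⟩
      star B (starEmbed t j zero) (starEmbed t j y)   ≡⟨ cong (λ v → star B v (starEmbed t j y)) (starEmbed-cut j i) ⟩
      star B (starEmbed t i zero) (starEmbed t j y)   ∎
      where open ≡-Reasoning
    entry i j (suc s) zero    | no i≢j   = begin
      A (block i (suc s)) (block j zero)                     ≡⟨ cong (A (block i (suc s))) (trans (block-zero j) (sym (block-zero i))) ⟩
      A (block i (suc s)) (block i zero)                     ≡⟨ entry-within i (suc s) zero ⟩
      star B (starEmbed t i (suc s)) (starEmbed t i zero)    ≡⟨ cong (star B (starEmbed t i (suc s))) (starEmbed-cut i j) ⟩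
      star B (starEmbed t i (suc s)) (starEmbed t j zero)    ∎
      where open ≡-Reasoning
    entry i j (suc s) (suc s′) | no i≢j  = trans (no-arc i j s s′ i≢j) (sym (star-offBlock B i j s s′ i≢j))

    relabel-σ : ∀ r c → relabel σ A r c ≡ star B r c
    relabel-σ r c with decompose r | decompose c
    ... | i , x , refl | j , y , refl rewrite σ-starEmbed i x | σ-starEmbed j y = entry i j x y

  det-starGluing : det A ≡ det (star B)
  det-starGluing = trans (sym (det-relabel σ σ-injective σ-surjective A)) (det-cong relabel-σ)

-- rotate x = x + 1 modulo suc m (Fin.lift 1 suc keeps a wrapped-around zero at zero).
rotate : ∀ {m} → Fin (suc m) → Fin (suc m)
rotate {zero}  zero    = zero
rotate {suc m} zero    = suc zero
rotate {suc m} (suc x) = Fin.lift 1 suc (rotate x)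

rotate-fromℕ : ∀ m → rotate (Fin.fromℕ m) ≡ zero
rotate-fromℕ zero                          = refl
rotate-fromℕ (suc m) rewrite rotate-fromℕ m = refl

rotate-inject₁ : ∀ {m} (y : Fin m) → rotate (Fin.inject₁ y) ≡ suc y
rotate-inject₁ {suc m} zero                              = refl
rotate-inject₁ {suc m} (suc y) rewrite rotate-inject₁ y = refl

fromℕ-or-inject₁ : ∀ {m} (x : Fin (suc m)) → x ≡ Fin.fromℕ m ⊎ ∃[ y ] x ≡ Fin.inject₁ y
fromℕ-or-inject₁ {zero}  zero    = inj₁ refl
fromℕ-or-inject₁ {suc m} zero    = inj₂ (zero , refl)
fromℕ-or-inject₁ {suc m} (suc x) with fromℕ-or-inject₁ x
... | inj₁ eq       = inj₁ (cong suc eq)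
... | inj₂ (y , eq) = inj₂ (suc y , cong suc eq)

rotate-injective : ∀ {m} → Injective _≡_ _≡_ (rotate {m})
rotate-injective {m} {x} {y} eq with fromℕ-or-inject₁ x | fromℕ-or-inject₁ y
... | inj₁ refl        | inj₁ refl        = refl
... | inj₁ refl        | inj₂ (y′ , refl) with () ← trans (sym (rotate-fromℕ m)) (trans eq (rotate-inject₁ y′))
... | inj₂ (x′ , refl) | inj₁ refl        with () ← trans (sym (rotate-inject₁ x′)) (trans eq (rotate-fromℕ m))
... | inj₂ (x′ , refl) | inj₂ (y′ , refl) =
  cong Fin.inject₁ (FinP.suc-injective (trans (sym (rotate-inject₁ x′)) (trans eq (rotate-inject₁ y′))))

does-≟-toℕ : ∀ {n} (x y : Fin n) → does (x ≟ y) ≡ (toℕ x ≡ᵇ toℕ y)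
does-≟-toℕ x y = does-⇔ (mk⇔ (cong toℕ) FinP.toℕ-injective) (x ≟ y) (toℕ x ℕ.≟ toℕ y)

does-≟-injective : ∀ {m n} (f : Fin m → Fin n) → Injective _≡_ _≡_ f → ∀ x y → does (f x ≟ f y) ≡ does (x ≟ y)
does-≟-injective f inj x y = does-⇔ (mk⇔ inj (cong f)) (f x ≟ f y) (x ≟ y)

≡ᵇ-sym : ∀ a b → (a ≡ᵇ b) ≡ (b ≡ᵇ a)
≡ᵇ-sym a b = does-⇔ (mk⇔ sym sym) (a ℕ.≟ b) (b ℕ.≟ a)

succᵇ-rotate : ∀ {m} (a b : Fin (suc m)) → succᵇ (suc m) (toℕ a) (toℕ b) ≡ does (rotate a ≟ b)
succᵇ-rotate {m} a b with fromℕ-or-inject₁ a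
... | inj₁ refl
  rewrite FinP.toℕ-fromℕ m | rotate-fromℕ m | dec-true (m ℕ.≟ m) refl
        | dec-false (toℕ b ℕ.≟ suc m) (ℕP.<⇒≢ (FinP.toℕ<n b))
        = trans (≡ᵇ-sym (toℕ b) 0) (sym (does-≟-toℕ zero b))
... | inj₂ (y , refl)
  rewrite FinP.toℕ-inject₁ y | rotate-inject₁ y | dec-false (toℕ y ℕ.≟ m) (ℕP.<⇒≢ (FinP.toℕ<n y))
        | ∨-identityʳ (toℕ b ≡ᵇ suc (toℕ y))
        = trans (≡ᵇ-sym (toℕ b) (suc (toℕ y))) (sym (does-≟-toℕ (suc y) b))

mKᵇ : Bool → Bool → Bool → ℤ
mKᵇ arc loop reverse = if arc then - 1ℤ else (if loop ∨ reverse then 0ℤ else 1ℤ)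

mK-rotate-view : ∀ {m} (a b : Fin (suc m)) →
  mK (suc m) a b ≡ mKᵇ (does (rotate a ≟ b)) (does (a ≟ b)) (does (rotate b ≟ a))
mK-rotate-view a b rewrite sym (succᵇ-rotate a b) | sym (succᵇ-rotate b a) | does-≟-toℕ a b = refl

mK-rotate : ∀ {m} (a b : Fin (suc m)) → mK (suc m) (rotate a) (rotate b) ≡ mK (suc m) a b
mK-rotate a b rewrite mK-rotate-view (rotate a) (rotate b) | mK-rotate-view a b
  | does-≟-injective rotate rotate-injective (rotate a) b
  | does-≟-injective rotate rotate-injective a b
  | does-≟-injective rotate rotate-injective (rotate b) a = refl

rotate^ : ∀ {m} → ℕ → Fin (suc m) → Fin (suc m)
rotate^ zero    x = x
rotate^ (suc k) x = rotate (rotate^ k x)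

mK-rotate^ : ∀ {m} k (a b : Fin (suc m)) → mK (suc m) (rotate^ k a) (rotate^ k b) ≡ mK (suc m) a b
mK-rotate^ zero    a b = refl
mK-rotate^ (suc k) a b = trans (mK-rotate (rotate^ k a) (rotate^ k b)) (mK-rotate^ k a b)

rotate^-injective : ∀ {m} k → Injective _≡_ _≡_ (rotate^ {m} k)
rotate^-injective zero    eq = eq
rotate^-injective (suc k) eq = rotate^-injective k (rotate-injective eq)

rotate-surjective : ∀ {m} → StrictlySurjective _≡_ (rotate {m})
rotate-surjective {m} zero    = Fin.fromℕ m , rotate-fromℕ m
rotate-surjective {m} (suc y) = Fin.inject₁ y , rotate-inject₁ y

rotate^-surjective : ∀ {m} k → StrictlySurjective _≡_ (rotate^ {m} k)
rotate^-surjective zero    y = y , refl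
rotate^-surjective (suc k) y with rotate-surjective y
... | z , eq with rotate^-surjective k z
...   | w , eq′ = w , trans (cong rotate eq′) eq

rotate^-toℕ : ∀ {m} (x : Fin (suc m)) → rotate^ (toℕ x) zero ≡ x
rotate^-toℕ x = go (toℕ x) x refl
  where
  go : ∀ {m} k (x : Fin (suc m)) → toℕ x ≡ k → rotate^ k zero ≡ x
  go zero    zero    eq = refl
  go {suc m} (suc k) (suc y) eq =
    trans (cong rotate (go k (Fin.inject₁ y) (trans (FinP.toℕ-inject₁ y) (ℕP.suc-injective eq)))) (rotate-inject₁ y)

-- A block of A isomorphic to m̄K_n through g, reindexed by a rotation so that c becomes vertex 0.
record CentredBlock {N} (A : Matrix N) (c : Fin N) (n : ℕ) (g : Fin n → Fin N) : Set where
  field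
    order           : ℕ
    n≡suc-order     : n ≡ suc order
    embed           : Fin (suc order) → Fin N
    embed-zero      : embed zero ≡ c
    embed-injective : Injective _≡_ _≡_ embed
    embed-arcs      : ∀ x y → A (embed x) (embed y) ≡ mK (suc order) x y
    embed-covers-g  : ∀ a → ∃[ x ] embed x ≡ g a
    g-covers-embed  : ∀ x → ∃[ a ] g a ≡ embed x

centre : ∀ {N} {A : Matrix N} {c n} (g : Fin n → Fin N) → Injective _≡_ _≡_ g → (∃[ a ] g a ≡ c) →
  (∀ a b → A (g a) (g b) ≡ mK n a b) → CentredBlock A c n g
centre {n = zero}  g g-injective (() , _)
centre {n = suc m} g g-injective (a , ga≡c) g-arcs = record
  { order           = m
  ; n≡suc-order     = refl
  ; embed           = g ∘ ρ
  ; embed-zero      = trans (cong g (rotate^-toℕ a)) ga≡c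
  ; embed-injective = rotate^-injective (toℕ a) ∘ g-injective
  ; embed-arcs      = λ x y → trans (g-arcs (ρ x) (ρ y)) (mK-rotate^ (toℕ a) x y)
  ; embed-covers-g  = λ b → proj₁ (rotate^-surjective (toℕ a) b) , cong g (proj₂ (rotate^-surjective (toℕ a) b))
  ; g-covers-embed  = λ x → ρ x , refl
  }
  where ρ = rotate^ (toℕ a)

module NegMixedStarBlock {N k} {n : Fin k → ℕ} {A : Matrix N} (G : IsNegMixedStarBlock N k n A) where
  open IsNegMixedStarBlock G

  centred : ∀ i → CentredBlock A c (n i) (f i)
  centred i = centre (f i) (f-inj i _ _) (f-cut i) (arcs i)

  module C i = CentredBlock (centred i)

  blocks : (i : Fin k) → Matrix (suc (C.order i))
  blocks i = mK (suc (C.order i))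

  private
    outside-block : ∀ l a i x → f l a ≡ C.embed i x → l ≢ i → x ≡ zero
    outside-block l a i x eq l≢i with C.g-covers-embed i x
    ... | b , fb≡ = C.embed-injective i (begin
      C.embed i x  ≡⟨ sym eq ⟩
      f l a        ≡⟨ disjoint l i a b l≢i (trans eq (sym fb≡)) ⟩
      c            ≡⟨ sym (C.embed-zero i) ⟩
      C.embed i zero ∎)
      where open ≡-Reasoning

    in-block : ∀ l a i s → f l a ≡ C.embed i (suc s) → l ≡ i
    in-block l a i s eq with l ≟ i
    ... | yes l≡i = l≡i
    ... | no l≢i with () ← outside-block l a i (suc s) eq l≢i

  isStarGluing : IsStarGluing blocks A
  isStarGluing = record
    { cut             = c
    ; block           = C.embed
    ; block-zero      = C.embed-zero
    ; block-injective = C.embed-injective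
    ; meet-at-cut     = λ i j x y i≢j eq → let b , fb≡ = C.g-covers-embed j y in
                          outside-block j b i x (trans fb≡ (sym eq)) (i≢j ∘ sym)
    ; cover           = λ v → let i , a , fa≡v = cover v ; x , ex≡ = C.embed-covers-g i a in
                          i , x , trans ex≡ fa≡v
    ; arcs            = C.embed-arcs
    ; no-arc          = λ i j s s′ i≢j → no-arc _ _ λ { (l , a , b , fa≡ , fb≡) →
                          i≢j (trans (sym (in-block l a i s fa≡)) (in-block l b j s′ fb≡)) }
    }

mK-zero-zero : ∀ {m} → 1 < suc m → mK (suc m) zero zero ≡ 0ℤ
mK-zero-zero {zero}  (s≤s ())
mK-zero-zero {suc m} _ = refl

prodExceptᶠ-cong : ∀ {k} {d d′ : Fin k → ℤ} → (∀ j → d j ≡ d′ j) → ∀ i → prodExceptᶠ d i ≡ prodExceptᶠ d′ i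
prodExceptᶠ-cong d≗d′ i = prodᶠ-cong (λ j → cong (λ x → if does (j ≟ i) then 1ℤ else x) (d≗d′ j))

theorem13 : (N k : ℕ) (n : Fin k → ℕ) → (∀ i → 3 < n i) → (A : Matrix N)
    → IsNegMixedStarBlock N k n A
    → det A ≡ sumᶠ (λ i → det (mK (n i)) * prodExcept n i)
theorem13 N k n n>3 A G = begin
  det A
    ≡⟨ det-starGluing isStarGluing loopless ⟩
  det (star blocks)
    ≡⟨ det-star blocks loopless ⟩
  sumᶠ (λ i → det (blocks i) * prodExceptᶠ (λ j → D (suc (C.order j))) i)
    ≡⟨ sumᶠ-cong (λ i → cong₂ _*_ (cong (det ∘ mK) (sym (C.n≡suc-order i)))
                                  (prodExceptᶠ-cong (λ j → cong D (sym (C.n≡suc-order j))) i)) ⟩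
  sumᶠ (λ i → det (mK (n i)) * prodExcept n i) ∎
  where
  open ≡-Reasoning
  open NegMixedStarBlock G
  loopless : Loopless blocks
  loopless i = mK-zero-zero (subst (1 <_) (C.n≡suc-order i) (ℕP.<-trans (s≤s (s≤s ℕ.z≤n)) (n>3 i)))
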